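{- In a bi-flock chicken graph whose two flocks are balanced, each flock contains a 3-Duke.
   Context: A bi-flock chicken graph is a finite orientation of a complete bipartite graph; vertices are chickens, the two partite sets are flocks, and "$c$ pecks $d$" means the edge is oriented from $c$ to $d$. A peck chain is a directed path. A chicken $d$ is a 3-Duke if every chicken not in the flock of $d$ can be reached from $d$ by a peck chain of length at most $3$. Two flocks are balanced if no chicken in either flock pecks all chickens of the other flock. -}

module Defs where

open import Data.Nat using (ℕ; zero; suc)
open import Data.Fin using (Fin)
open import Data.Bool using (Bool; true; false)
open import Data.Sum using (_⊎_; inj₁; inj₂)
open import Data.Product using (Σ; ∃; _×_; _,_)
open import Data.Empty using (⊥)
open import Data.Unit using (⊤)
open import Relation.Binary.PropositionalEquality using (_≡_)
open import Relation.Nullary using (¬_)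

-- A bi-flock chicken graph with flocks A = Fin m and B = Fin n:
-- an orientation of the complete bipartite graph K_{m,n}.
-- ori a b ≡ true  means  a pecks b ;  ori a b ≡ false  means  b pecks a.
Orientation : ℕ → ℕ → Set
Orientation m n = Fin m → Fin n → Bool

Chicken : ℕ → ℕ → Set
Chicken m n = Fin m ⊎ Fin n

Pecks : ∀ {m n} → Orientation m n → Chicken m n → Chicken m n → Set
Pecks P (inj₁ a) (inj₁ a') = ⊥
Pecks P (inj₁ a) (inj₂ b)  = P a b ≡ true
Pecks P (inj₂ b) (inj₁ a)  = P a b ≡ false
Pecks P (inj₂ b) (inj₂ b') = ⊥

SameFlock : ∀ {m n} → Chicken m n → Chicken m n → Set
SameFlock (inj₁ _) (inj₁ _) = ⊤
SameFlock (inj₁ _) (inj₂ _) = ⊥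
SameFlock (inj₂ _) (inj₁ _) = ⊥
SameFlock (inj₂ _) (inj₂ _) = ⊤

-- Reach P k c d : there is a peck chain (directed walk) from c to d of
-- length at most k.  (In an orientation of a bipartite graph, a directed
-- walk of length ≤ 3 between chickens of different flocks is automatically
-- a directed path.)
data Reach {m n} (P : Orientation m n) : ℕ → Chicken m n → Chicken m n → Set where
  here : ∀ {k c} → Reach P k c c
  step : ∀ {k c e d} → Pecks P c e → Reach P k e d → Reach P (suc k) c d

ThreeDuke : ∀ {m n} → Orientation m n → Chicken m n → Set
ThreeDuke P d = ∀ c → ¬ SameFlock d c → Reach P 3 d c

Balanced : ∀ {m n} → Orientation m n → Set
Balanced {m} {n} P =
  (∀ (a : Fin m) → ¬ (∀ (b : Fin n) → Pecks P (inj₁ a) (inj₂ b))) ×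
  (∀ (b : Fin n) → ¬ (∀ (a : Fin m) → Pecks P (inj₂ b) (inj₁ a)))

-- A chicken a of flock A pecking the most chickens of flock B is a 3-Duke
-- (Maurer's king chicken argument). If a does not peck b, then some a'
-- pecks b, since b does not peck all of flock A. Were every victim of a also
-- a victim of a', then a' would have strictly more victims than a. So a pecks
-- some b' that pecks a', and a → b' → a' → b is a peck chain. Flock B is
-- handled by reversing every edge, which swaps the roles of the flocks.
module Submission where

open import Defs
open import Data.Nat using (ℕ; suc; _≤_)
open import Data.Nat.Properties using (<⇒≱)
open import Data.Bool using (Bool; true; false; not; _≟_)
open import Data.Bool.Properties using (not-injective; ¬-not)
open import Data.Fin using (Fin; zero)
open import Data.Fin.Subset using (Subset; _∈_; _∉_; _⊆_; ∣_∣)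
open import Data.Fin.Subset.Properties using (_∈?_; p⊂q⇒∣p∣<∣q∣)
open import Data.Fin.Properties using (any?; ¬∀⟶∃¬)
open import Data.Vec using (tabulate)
open import Data.Vec.Properties using (lookup∘tabulate; lookup⇒[]=; []=⇒lookup)
open import Data.List using (allFin)
open import Data.List.Membership.Propositional.Properties using (∈-allFin)
open import Data.List.Relation.Unary.All as All using ()
open import Data.List.Extrema.Nat using (argmax; f[xs]≤f[argmax])
open import Data.Sum using (inj₁; inj₂; _⊎_; swap)
open import Data.Product using (∃; _×_; _,_; proj₂; map₂)
open import Data.Empty using (⊥-elim)
open import Data.Unit using (tt)
open import Relation.Nullary using (¬_; yes; no; contradiction)
open import Relation.Nullary.Decidable using (_×-dec_; ¬?; decidable-stable)
open import Function using (_∘_)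
open import Relation.Binary.PropositionalEquality using (_≡_; sym; trans)

⊆⊎∃∈∉ : ∀ {n} (p q : Subset n) → p ⊆ q ⊎ ∃ λ x → x ∈ p × x ∉ q
⊆⊎∃∈∉ p q with any? (λ x → x ∈? p ×-dec ¬? (x ∈? q))
... | yes escape = inj₂ escape
... | no ¬escape = inj₁ λ {x} x∈p →
  decidable-stable (x ∈? q) (λ x∉q → ¬escape (x , x∈p , x∉q))

∈-tabulate⁺ : ∀ {n} {f : Fin n → Bool} {x} → f x ≡ true → x ∈ tabulate f
∈-tabulate⁺ {f = f} {x} fx = lookup⇒[]= x (tabulate f) (trans (lookup∘tabulate f x) fx)

∈-tabulate⁻ : ∀ {n} {f : Fin n → Bool} {x} → x ∈ tabulate f → f x ≡ true
∈-tabulate⁻ {f = f} {x} x∈ = trans (sym (lookup∘tabulate f x)) ([]=⇒lookup x∈)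

∉-tabulate⁺ : ∀ {n} {f : Fin n → Bool} {x} → f x ≡ false → x ∉ tabulate f
∉-tabulate⁺ fx x∈ with () ← trans (sym fx) (∈-tabulate⁻ x∈)

∉-tabulate⁻ : ∀ {n} {f : Fin n → Bool} {x} → x ∉ tabulate f → f x ≡ false
∉-tabulate⁻ x∉ = ¬-not (x∉ ∘ ∈-tabulate⁺)

module _ {m n} (P : Orientation m n) where

  victims : Fin m → Subset n
  victims a = tabulate (P a)

  score : Fin m → ℕ
  score a = ∣ victims a ∣

  pecker : (∀ b → ¬ (∀ a → Pecks P (inj₂ b) (inj₁ a))) →
           ∀ b → ∃ λ a → P a b ≡ true
  pecker unbeaten b with ¬∀⟶∃¬ m _ (λ a → P a b ≟ false) (unbeaten b)
  ... | a , ¬ab = a , ¬-not ¬ab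

  maxScore⇒ThreeDuke : (∀ b → ¬ (∀ a → Pecks P (inj₂ b) (inj₁ a))) →
                       ∀ {a} → (∀ a' → score a' ≤ score a) → ThreeDuke P (inj₁ a)
  maxScore⇒ThreeDuke _ _ (inj₁ _) ns = ⊥-elim (ns tt)
  maxScore⇒ThreeDuke unbeaten {a} maximal (inj₂ b) _ with P a b in ab
  ... | true = step ab here
  ... | false with pecker unbeaten b
  ... | a' , a'b with ⊆⊎∃∈∉ (victims a) (victims a')
  ... | inj₂ (b' , b'∈ , b'∉) =
    step {e = inj₂ b'} (∈-tabulate⁻ b'∈)
      (step {e = inj₁ a'} (∉-tabulate⁻ b'∉) (step a'b here))
  ... | inj₁ sub =
    contradiction (maximal a') (<⇒≱ (p⊂q⇒∣p∣<∣q∣ (sub , b , ∈-tabulate⁺ a'b , ∉-tabulate⁺ ab)))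

flockA-ThreeDuke : ∀ {m n} (P : Orientation (suc m) n) →
                   (∀ b → ¬ (∀ a → Pecks P (inj₂ b) (inj₁ a))) →
                   ∃ λ a → ThreeDuke P (inj₁ a)
flockA-ThreeDuke {m} P unbeaten = king , maxScore⇒ThreeDuke P unbeaten maximal
  where
  king : Fin (suc m)
  king = argmax (score P) zero (allFin (suc m))

  maximal : ∀ a → score P a ≤ score P king
  maximal a = All.lookup (f[xs]≤f[argmax] {f = score P} zero (allFin (suc m))) (∈-allFin a)

reverse : ∀ {m n} → Orientation m n → Orientation n m
reverse P b a = not (P a b)

module _ {m n} {P : Orientation m n} where

  Pecks-reverse : ∀ {c d} → Pecks (reverse P) c d → Pecks P (swap c) (swap d)
  Pecks-reverse {inj₁ b} {inj₂ a} = not-injective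
  Pecks-reverse {inj₂ a} {inj₁ b} = not-injective

  Reach-reverse : ∀ {k c d} → Reach (reverse P) k c d → Reach P k (swap c) (swap d)
  Reach-reverse here         = here
  Reach-reverse (step ce ed) = step (Pecks-reverse ce) (Reach-reverse ed)

  Balanced-reverse : Balanced P → Balanced (reverse P)
  Balanced-reverse (balA , balB) =
    (λ b peckAll → balB b (not-injective ∘ peckAll)) ,
    (λ a peckAll → balA a (not-injective ∘ peckAll))

  ThreeDuke-reverse : ∀ {b} → ThreeDuke (reverse P) (inj₁ b) → ThreeDuke P (inj₂ b)
  ThreeDuke-reverse duke (inj₁ a) _  = Reach-reverse (duke (inj₂ a) λ ())
  ThreeDuke-reverse duke (inj₂ _) ns = ⊥-elim (ns tt)

corollary1 : (m n : ℕ) → (P : Orientation (suc m) (suc n)) → Balanced P →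
    (∃ λ (a : Fin (suc m)) → ThreeDuke P (inj₁ a)) ×
    (∃ λ (b : Fin (suc n)) → ThreeDuke P (inj₂ b))
corollary1 m n P bal =
  flockA-ThreeDuke P (proj₂ bal) ,
  map₂ ThreeDuke-reverse (flockA-ThreeDuke (reverse P) (proj₂ (Balanced-reverse bal)))
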